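{- The binary midpoint function $\mathrm{mid}$ on ternary signed-digit encodings is uniformly continuous in the following sense: for every $\varepsilon\in\mathbb{N}$ there are $\delta_1,\delta_2\in\mathbb{N}$ such that for all $x_1,x_2,y_1,y_2:\mathbb{N}\to\{\bar1,0,1\}$, if $x_1\sim^{\delta_1}x_2$ and $y_1\sim^{\delta_2}y_2$ then $\mathrm{mid}(x_1,y_1)\sim^{\varepsilon}\mathrm{mid}(x_2,y_2)$.
   Context: For sequences $\alpha,\beta$, $\alpha\sim^n\beta$ means $\alpha_i=\beta_i$ for all $i<n$. Ternary digits $\{\bar1,0,1\}$ denote $-1,0,1$; quinary digits are $\{ -2,-1,0,1,2\}$; $\mathrm{add3}(a,b)$ is the integer sum of two ternary digits. Define $d:\{ -2,\dots,2\}^2\to\{\bar1,0,1\}\times\{ -2,\dots,2\}$ by $d(-2,y)=(\bar1,y)$, $d(0,y)=(0,y)$, $d(2,y)=(1,y)$, $d(-1,-2)=(\bar1,0)$, $d(-1,-1)=(\bar1,1)$, $d(-1,0)=(0,-2)$, $d(-1,1)=(0,-1)$, $d(-1,2)=(0,0)$, $d(1,-2)=(0,0)$, $d(1,-1)=(0,1)$, $d(1,0)=(0,2)$, $d(1,1)=(1,-1)$, $d(1,2)=(1,0)$. For $\gamma:\mathbb{N}\to\{ -2,\dots,2\}$, $\mathrm{div2}(\gamma)_0:=\pi_1d(\gamma_0,\gamma_1)$ and $\mathrm{div2}(\gamma)_{n+1}:=\mathrm{div2}(\pi_2d(\gamma_0,\gamma_1)::\mathrm{tail}(\mathrm{tail}\,\gamma))_n$,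 where $x::\gamma$ prepends $x$. Then $\mathrm{mid}(\alpha,\beta):=\mathrm{div2}(n\mapsto\mathrm{add3}(\alpha_n,\beta_n))$. -}

module Defs where

open import Data.Nat using (ℕ; zero; suc; _<_)
open import Data.Product using (_×_; _,_; proj₁; proj₂)
open import Relation.Binary.PropositionalEquality using (_≡_)

data 𝟛 : Set where
  −1 0₃ +1 : 𝟛

data 𝟝 : Set where
  −2 −1₅ 0₅ +1₅ +2 : 𝟝

_∼⟨_⟩_ : {X : Set} → (ℕ → X) → ℕ → (ℕ → X) → Set
α ∼⟨ n ⟩ β = ∀ i → i < n → α i ≡ β i

add3 : 𝟛 → 𝟛 → 𝟝
add3 −1 −1 = −2
add3 −1 0₃ = −1₅
add3 −1 +1 = 0₅
add3 0₃ −1 = −1₅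
add3 0₃ 0₃ = 0₅
add3 0₃ +1 = +1₅
add3 +1 −1 = 0₅
add3 +1 0₃ = +1₅
add3 +1 +1 = +2

d : 𝟝 → 𝟝 → 𝟛 × 𝟝
d −2 y = −1 , y
d 0₅ y = 0₃ , y
d +2 y = +1 , y
d −1₅ −2  = −1 , 0₅
d −1₅ −1₅ = −1 , +1₅
d −1₅ 0₅  = 0₃ , −2
d −1₅ +1₅ = 0₃ , −1₅
d −1₅ +2  = 0₃ , 0₅
d +1₅ −2  = 0₃ , 0₅
d +1₅ −1₅ = 0₃ , +1₅
d +1₅ 0₅  = 0₃ , +2
d +1₅ +1₅ = +1 , −1₅
d +1₅ +2  = +1 , 0₅

_∷ₛ_ : {X : Set} → X → (ℕ → X) → (ℕ → X)
(x ∷ₛ γ) zero = x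
(x ∷ₛ γ) (suc n) = γ n

tailₛ : {X : Set} → (ℕ → X) → (ℕ → X)
tailₛ γ n = γ (suc n)

div2 : (ℕ → 𝟝) → (ℕ → 𝟛)
div2 γ zero = proj₁ (d (γ 0) (γ 1))
div2 γ (suc n) = div2 (proj₂ (d (γ 0) (γ 1)) ∷ₛ tailₛ (tailₛ γ)) n

mid : (ℕ → 𝟛) → (ℕ → 𝟛) → (ℕ → 𝟛)
mid α β = div2 (λ n → add3 (α n) (β n))

module Submission where

-- Output digit n of div2 is computed from input digits 0, …, n+1 only, so div2 has
-- modulus of continuity n ↦ n+1; add3 acts digitwise, so mid inherits that modulus.

open import Defs
open import Data.Nat using (ℕ; zero; suc; _<_; s≤s; z≤n)
open import Data.Product using (Σ; _,_; proj₁; proj₂)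
open import Relation.Binary.PropositionalEquality using (_≡_; cong; cong₂)

module _ {X : Set} where

  ∼-∷ₛ : {x x′ : X} {α α′ : ℕ → X} {n : ℕ} →
         x ≡ x′ → α ∼⟨ n ⟩ α′ → (x ∷ₛ α) ∼⟨ suc n ⟩ (x′ ∷ₛ α′)
  ∼-∷ₛ x≡x′ α∼α′ zero    _         = x≡x′
  ∼-∷ₛ x≡x′ α∼α′ (suc i) (s≤s i<n) = α∼α′ i i<n

  ∼-tailₛ : {α α′ : ℕ → X} {n : ℕ} → α ∼⟨ suc n ⟩ α′ → tailₛ α ∼⟨ n ⟩ tailₛ α′
  ∼-tailₛ α∼α′ i i<n = α∼α′ (suc i) (s≤s i<n)

∼-zipWith : {X Y Z : Set} (f : X → Y → Z) {α α′ : ℕ → X} {β β′ : ℕ → Y} {n : ℕ} →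
            α ∼⟨ n ⟩ α′ → β ∼⟨ n ⟩ β′ →
            (λ i → f (α i) (β i)) ∼⟨ n ⟩ (λ i → f (α′ i) (β′ i))
∼-zipWith f α∼α′ β∼β′ i i<n = cong₂ f (α∼α′ i i<n) (β∼β′ i i<n)

div2-carry : (ℕ → 𝟝) → (ℕ → 𝟝)
div2-carry γ = proj₂ (d (γ 0) (γ 1)) ∷ₛ tailₛ (tailₛ γ)

d-head-∼ : {γ γ′ : ℕ → 𝟝} {n : ℕ} → γ ∼⟨ suc (suc n) ⟩ γ′ → d (γ 0) (γ 1) ≡ d (γ′ 0) (γ′ 1)
d-head-∼ γ∼γ′ = cong₂ d (γ∼γ′ 0 (s≤s z≤n)) (γ∼γ′ 1 (s≤s (s≤s z≤n)))

div2-carry-∼ : {γ γ′ : ℕ → 𝟝} {n : ℕ} →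
               γ ∼⟨ suc (suc n) ⟩ γ′ → div2-carry γ ∼⟨ suc n ⟩ div2-carry γ′
div2-carry-∼ γ∼γ′ = ∼-∷ₛ (cong proj₂ (d-head-∼ γ∼γ′)) (∼-tailₛ (∼-tailₛ γ∼γ′))

div2-∼ : (n : ℕ) {γ γ′ : ℕ → 𝟝} → γ ∼⟨ suc n ⟩ γ′ → div2 γ ∼⟨ n ⟩ div2 γ′
div2-∼ zero    γ∼γ′ i       ()
div2-∼ (suc n) γ∼γ′ zero    _         = cong proj₁ (d-head-∼ γ∼γ′)
div2-∼ (suc n) γ∼γ′ (suc i) (s≤s i<n) = div2-∼ n (div2-carry-∼ γ∼γ′) i i<n

mid-∼ : (n : ℕ) {x₁ x₂ y₁ y₂ : ℕ → 𝟛} →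
        x₁ ∼⟨ suc n ⟩ x₂ → y₁ ∼⟨ suc n ⟩ y₂ → mid x₁ y₁ ∼⟨ n ⟩ mid x₂ y₂
mid-∼ n x∼ y∼ = div2-∼ n (∼-zipWith add3 x∼ y∼)

corollary6p23 : (ε : ℕ) → Σ ℕ λ δ₁ → Σ ℕ λ δ₂ →
    (x₁ x₂ y₁ y₂ : ℕ → 𝟛) →
    x₁ ∼⟨ δ₁ ⟩ x₂ → y₁ ∼⟨ δ₂ ⟩ y₂ → mid x₁ y₁ ∼⟨ ε ⟩ mid x₂ y₂
corollary6p23 ε = suc ε , suc ε , λ _ _ _ _ → mid-∼ ε
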